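{- Let $n\ge 3$ be odd and let $S\subseteq\{1,\ldots,n-1\}$ with $1\in S$ such that $S$ contains an even integer. Then $\overrightarrow{pc}(C_n(S))\le 2$.
   Context: All digraphs are finite, loopless, without parallel arcs (opposite arcs are allowed). A directed path in an arc-coloured digraph is properly coloured if no two consecutive arcs on it have the same colour. An arc-colouring of $D$ makes $D$ properly connected if for every ordered pair $(u,v)$ of distinct vertices there is a properly coloured directed $uv$-path; $\overrightarrow{pc}(D)$ is the minimum number of colours in such an arc-colouring. For $n\ge 3$ and $S\subseteq\{1,\ldots,n-1\}$, the circulant digraph $C_n(S)$ has vertex set $\{v_0,\ldots,v_{n-1}\}$ and arc set $\{v_iv_j : j-i\equiv s \pmod n \text{ for some } s\in S\}$. -}

module Defs where

open import Data.Nat using (ℕ; zero; suc; _+_; _∸_; _≤_; _<_; NonZero)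
open import Data.Nat.DivMod using (_%_)
open import Data.Fin using (Fin; toℕ)
open import Data.List using (List; []; _∷_)
open import Data.List.Relation.Unary.Unique.Propositional using (Unique)
open import Data.List.Relation.Unary.All using (All)
open import Data.Product using (Σ; ∃; _×_; _,_)
open import Relation.Binary.PropositionalEquality using (_≡_; _≢_)
open import Relation.Nullary using (¬_)
open import Data.Unit using (⊤)
open import Data.Maybe using (Maybe; nothing; just)

Digraph : ℕ → Set₁
Digraph n = Fin n → Fin n → Set

-- Circulant digraph C_n(S) : v_i v_j is an arc iff (j - i) mod n ∈ S.
-- S is a set of naturals (a predicate), required by the statement to lie in {1,…,n-1}.
Circulant : (n : ℕ) .{{_ : NonZero n}} → (S : ℕ → Set) → Digraph n
Circulant n S i j = S ((toℕ j + (n ∸ toℕ i)) % n)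

-- An arc-colouring with k colours: a colour for every ordered pair (only arcs matter).
ArcColouring : ℕ → ℕ → Set
ArcColouring n k = Fin n → Fin n → Fin k

Differs : {k : ℕ} → Maybe (Fin k) → Fin k → Set
Differs nothing    _   = ⊤
Differs (just p) col = p ≢ col

data PCWalk {n k : ℕ} (D : Digraph n) (c : ArcColouring n k)
     : Maybe (Fin k) → Fin n → List (Fin n) → Fin n → Set where
  stop : ∀ {prev u} → PCWalk D c prev u [] u
  step : ∀ {prev u w vs v} →
         D u w → Differs prev (c u w) →
         PCWalk D c (just (c u w)) w vs v →
         PCWalk D c prev u (w ∷ vs) v

ProperlyColouredPath : {n k : ℕ} → Digraph n → ArcColouring n k → Fin n → Fin n → Set
ProperlyColouredPath {n} D c u v =
  Σ (List (Fin n)) λ vs → Unique (u ∷ vs) × PCWalk D c nothing u vs v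

ProperlyConnected : {n k : ℕ} → Digraph n → ArcColouring n k → Set
ProperlyConnected D c = ∀ u v → u ≢ v → ProperlyColouredPath D c u v

-- pc→(D) ≤ k : some arc-colouring with (at most) k colours makes D properly connected.
-- (Using exactly the colour set Fin k is equivalent, as unused colours are allowed.)
PCNumberAtMost : {n : ℕ} → Digraph n → ℕ → Set
PCNumberAtMost {n} D k = Σ (ArcColouring n k) λ c → ProperlyConnected D c

-- Colour every arc by the parity of its tail. A walk along which consecutive vertices have
-- different parities is then properly coloured, and this property survives cutting out a
-- closed subwalk, so every such walk shortens to a properly coloured path. In C_n(S) the
-- arcs i → i + 1 and i + (n − e) → i (e ∈ S even, so n − e is odd since n is odd) change
-- parity whenever they do not wrap around; using only those, every vertex first descends
-- to v₀ and then climbs to any other vertex.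
module Submission where

open import Defs
open import Level using (_⊔_)
open import Data.Nat
  using (ℕ; zero; suc; _+_; _∸_; _%_; _≤_; _<_; z≤n; s≤s; _≤?_; NonZero; >-nonZero⁻¹; parity)
open import Data.Nat.Properties
  using (+-comm; +-assoc; +-identityʳ; +-∸-assoc; [m+n]∸[m+o]≡n∸o; m+n∸m≡n; m+[n∸m]≡n; m∸n+n≡m;
         m∸n≤m; ∸-monoʳ-<; m<m+n; +-monoʳ-≤; +-monoˡ-≤; n≢0⇒n>0; ≤-reflexive; ≤-trans; ≤-<-trans; <⇒≤; ≰⇒>)
open import Data.Nat.DivMod using ([m+n]%n≡m%n; m<n⇒m%n≡m)
open import Data.Nat.Divisibility using (_∣_; _∣0; ∣-refl; ∣m∣n⇒∣m+n)
open import Data.Parity.Base as ℙ using (Parity; 0ℙ; 1ℙ; _⁻¹)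
open import Data.Parity.Properties using (+-homo-+; p≢p⁻¹) renaming (+-comm to ℙ+-comm)
open import Data.Fin as Fin using (Fin; toℕ; fromℕ<; _≟_) renaming (_<_ to _<ᶠ_)
open import Data.Fin.Properties using (toℕ-fromℕ<; toℕ<n; toℕ-injective)
open import Data.Fin.Induction using (<-wellFounded)
open import Data.List using (List; []; _∷_)
open import Data.List.Membership.DecPropositional using (_∈?_)
open import Data.List.Membership.Propositional using (_∈_)
open import Data.List.Relation.Unary.Any using (here; there)
open import Data.List.Relation.Unary.All using ([])
open import Data.List.Relation.Unary.All.Properties using (¬Any⇒All¬)
open import Data.List.Relation.Unary.AllPairs using ([]; _∷_)
open import Data.List.Relation.Unary.Unique.Propositional using (Unique)
open import Data.Product using (Σ; _×_; _,_; proj₁; proj₂)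
open import Data.Empty using (⊥-elim)
open import Data.Unit using (tt)
open import Function using (_∘_)
open import Function.Definitions using (Injective)
open import Induction.WellFounded using (Acc; acc)
open import Relation.Binary.Core using (Rel)
open import Relation.Binary.Definitions using (DecidableEquality)
open import Relation.Binary.Construct.Closure.ReflexiveTransitive using (Star; ε; _◅_; _◅◅_)
open import Relation.Binary.PropositionalEquality
open import Relation.Nullary using (¬_; yes; no)

data Walk {a ℓ} {A : Set a} (R : Rel A ℓ) : A → List A → A → Set (a ⊔ ℓ) where
  []  : ∀ {u} → Walk R u [] u
  _∷_ : ∀ {u w vs v} → R u w → Walk R w vs v → Walk R u (w ∷ vs) v

Path : ∀ {a ℓ} {A : Set a} → Rel A ℓ → A → A → Set (a ⊔ ℓ)
Path {A = A} R u v = Σ (List A) λ vs → Unique (u ∷ vs) × Walk R u vs v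

module _ {a ℓ} {A : Set a} {R : Rel A ℓ} (_≟ᴬ_ : DecidableEquality A) where

  suffix⇒Path : ∀ {u x vs v} → u ∈ x ∷ vs → Unique (x ∷ vs) → Walk R x vs v → Path R u v
  suffix⇒Path (here refl)   U       W       = _ , U , W
  suffix⇒Path (there u∈vs) (_ ∷ U) (r ∷ W) = suffix⇒Path u∈vs U W

  Star⇒Path : ∀ {u v} → Star R u v → Path R u v
  Star⇒Path ε = [] , [] ∷ [] , []
  Star⇒Path {u} (_◅_ {j = w} r rs) with Star⇒Path rs
  ... | vs , U , W with _∈?_ _≟ᴬ_ u (w ∷ vs)
  ...   | yes u∈w∷vs = suffix⇒Path u∈w∷vs U W
  ...   | no  u∉w∷vs = w ∷ vs , ¬Any⇒All¬ (w ∷ vs) u∉w∷vs ∷ U , r ∷ W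

module TailColouring {n k} (D : Digraph n) (κ : Fin n → Fin k) where

  tailColouring : ArcColouring n k
  tailColouring u _ = κ u

  Alternating : Rel (Fin n) _
  Alternating u w = D u w × κ u ≢ κ w

  Walk⇒PCWalk : ∀ {prev u vs v} → Walk Alternating u vs v → Differs prev (κ u) →
                PCWalk D tailColouring prev u vs v
  Walk⇒PCWalk []                   _      = stop
  Walk⇒PCWalk ((uw , κu≢κw) ∷ W) differs = step uw differs (Walk⇒PCWalk W κu≢κw)

  stronglyConnected⇒properlyConnected : (∀ u v → Star Alternating u v) →
                                        ProperlyConnected D tailColouring
  stronglyConnected⇒properlyConnected reach u v _ with Star⇒Path _≟_ (reach u v)
  ... | vs , U , W = vs , U , Walk⇒PCWalk W tt

fromParity : Parity → Fin 2
fromParity 0ℙ = Fin.zero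
fromParity 1ℙ = Fin.suc Fin.zero

fromParity-injective : Injective _≡_ _≡_ fromParity
fromParity-injective {0ℙ} {0ℙ} _ = refl
fromParity-injective {1ℙ} {1ℙ} _ = refl

parity-+-odd : ∀ m {d} → parity d ≡ 1ℙ → parity (m + d) ≢ parity m
parity-+-odd m {d} pd eq = p≢p⁻¹ (parity m) (sym (begin
  parity m ⁻¹           ≡⟨ ℙ+-comm 1ℙ (parity m) ⟩
  parity m ℙ.+ 1ℙ       ≡⟨ cong (parity m ℙ.+_) pd ⟨
  parity m ℙ.+ parity d ≡⟨ +-homo-+ m d ⟨
  parity (m + d)        ≡⟨ eq ⟩
  parity m              ∎))
  where open ≡-Reasoning

¬2∣⇒parity≡1ℙ : ∀ m → ¬ 2 ∣ m → parity m ≡ 1ℙ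
¬2∣⇒parity≡1ℙ zero          ¬2∣0   = ⊥-elim (¬2∣0 (2 ∣0))
¬2∣⇒parity≡1ℙ (suc zero)    _      = refl
¬2∣⇒parity≡1ℙ (suc (suc m)) ¬2∣2+m = ¬2∣⇒parity≡1ℙ m (¬2∣2+m ∘ ∣m∣n⇒∣m+n ∣-refl)

module _ {n} .{{_ : NonZero n}} {S : ℕ → Set} where

  circulant-forward : ∀ {s} {u w : Fin n} → toℕ u + s ≡ toℕ w → s < n → S s →
                      Circulant n S u w
  circulant-forward {s} {u} {w} eq s<n Ss = subst S (sym (begin
    (toℕ w + (n ∸ toℕ u)) % n         ≡⟨ cong (λ x → (x + (n ∸ toℕ u)) % n) eq ⟨
    (toℕ u + s + (n ∸ toℕ u)) % n     ≡⟨ cong (λ x → (x + (n ∸ toℕ u)) % n) (+-comm (toℕ u) s) ⟩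
    (s + toℕ u + (n ∸ toℕ u)) % n     ≡⟨ cong (_% n) (+-assoc s (toℕ u) (n ∸ toℕ u)) ⟩
    (s + (toℕ u + (n ∸ toℕ u))) % n   ≡⟨ cong (λ x → (s + x) % n) (m+[n∸m]≡n (<⇒≤ (toℕ<n u))) ⟩
    (s + n) % n                       ≡⟨ [m+n]%n≡m%n s n ⟩
    s % n                             ≡⟨ m<n⇒m%n≡m s<n ⟩
    s                                 ∎)) Ss
    where open ≡-Reasoning

  circulant-backward : ∀ {d s} {u w : Fin n} → toℕ w + d ≡ toℕ u → d + s ≡ n → s < n → S s →
                       Circulant n S u w
  circulant-backward {d} {s} {u} {w} eq d+s≡n s<n Ss = subst S (sym (begin
    (toℕ w + (n ∸ toℕ u)) % n             ≡⟨ cong (_% n) (+-∸-assoc (toℕ w) (<⇒≤ (toℕ<n u))) ⟨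
    (toℕ w + n ∸ toℕ u) % n               ≡⟨ cong₂ (λ x y → (toℕ w + x ∸ y) % n) d+s≡n eq ⟨
    (toℕ w + (d + s) ∸ (toℕ w + d)) % n   ≡⟨ cong (_% n) ([m+n]∸[m+o]≡n∸o (toℕ w) (d + s) d) ⟩
    (d + s ∸ d) % n                       ≡⟨ cong (_% n) (m+n∸m≡n d s) ⟩
    s % n                                 ≡⟨ m<n⇒m%n≡m s<n ⟩
    s                                     ∎)) Ss
    where open ≡-Reasoning

module OddJump {n} .{{_ : NonZero n}} {S : ℕ → Set} (S1 : S 1) {f e : ℕ}
               (f+e≡n : f + e ≡ n) (f-odd : parity f ≡ 1ℙ) (0<e : 0 < e) (Se : S e) where

  open TailColouring (Circulant n S) (fromParity ∘ parity ∘ toℕ) public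

  0<f : 0 < f
  0<f = n≢0⇒n>0 λ f≡0 → 0ℙ≢1ℙ (trans (cong parity (sym f≡0)) f-odd)
    where
    0ℙ≢1ℙ : 0ℙ ≢ 1ℙ
    0ℙ≢1ℙ ()

  f<n : f < n
  f<n = subst (f <_) f+e≡n (m<m+n f 0<e)

  e<n : e < n
  e<n = subst (e <_) (trans (+-comm e f) f+e≡n) (m<m+n e 0<f)

  1<n : 1 < n
  1<n = ≤-trans (+-monoʳ-≤ 1 0<e) (≤-trans (+-monoˡ-≤ e 0<f) (≤-reflexive f+e≡n))

  odd-gap⇒alternating : ∀ {d} {x y : Fin n} → toℕ x + d ≡ toℕ y → parity d ≡ 1ℙ →
                        fromParity (parity (toℕ x)) ≢ fromParity (parity (toℕ y))
  odd-gap⇒alternating {x = x} x+d≡y pd κx≡κy =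
    parity-+-odd (toℕ x) pd (trans (cong parity x+d≡y) (sym (fromParity-injective κx≡κy)))

  step-up : ∀ {u w} → toℕ u + 1 ≡ toℕ w → Alternating u w
  step-up {u} eq = circulant-forward {S = S} eq 1<n S1 , odd-gap⇒alternating {x = u} eq refl

  jump-down : ∀ {u w} → toℕ w + f ≡ toℕ u → Alternating u w
  jump-down {w = w} eq =
    circulant-backward {S = S} eq f+e≡n e<n Se , ≢-sym (odd-gap⇒alternating {x = w} eq f-odd)

  ascend-by : ∀ d {u v} → toℕ u + d ≡ toℕ v → Star Alternating u v
  ascend-by zero    {u} eq = subst (Star Alternating u)
                                   (toℕ-injective (trans (sym (+-identityʳ (toℕ u))) eq)) ε
  ascend-by (suc d) {u} {v} eq = step-up (sym (toℕ-fromℕ< u+1<n)) ◅ ascend-by d next+d≡v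
    where
    u+1<n : toℕ u + 1 < n
    u+1<n = ≤-<-trans (+-monoʳ-≤ (toℕ u) (s≤s z≤n)) (subst (_< n) (sym eq) (toℕ<n v))
    next+d≡v : toℕ (fromℕ< u+1<n) + d ≡ toℕ v
    next+d≡v = trans (cong (_+ d) (toℕ-fromℕ< u+1<n)) (trans (+-assoc (toℕ u) 1 d) eq)

  ascend : ∀ {u v} → toℕ u ≤ toℕ v → Star Alternating u v
  ascend u≤v = ascend-by _ (m+[n∸m]≡n u≤v)

  origin : Fin n
  origin = fromℕ< (>-nonZero⁻¹ n)

  toℕ-origin : toℕ origin ≡ 0
  toℕ-origin = toℕ-fromℕ< (>-nonZero⁻¹ n)

  descend : ∀ u → Acc _<ᶠ_ u → Star Alternating u origin
  descend u (acc rs) with f ≤? toℕ u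
  ... | yes f≤u = jump-down lower+f≡u ◅ descend lower (rs lower<u)
    where
    u∸f<n : toℕ u ∸ f < n
    u∸f<n = ≤-<-trans (m∸n≤m (toℕ u) f) (toℕ<n u)
    lower : Fin n
    lower = fromℕ< u∸f<n
    lower+f≡u : toℕ lower + f ≡ toℕ u
    lower+f≡u = trans (cong (_+ f) (toℕ-fromℕ< u∸f<n)) (m∸n+n≡m f≤u)
    lower<u : lower <ᶠ u
    lower<u = subst (_< toℕ u) (sym (toℕ-fromℕ< u∸f<n)) (∸-monoʳ-< 0<f f≤u)
  ... | no f≰u = ascend u≤top ◅◅ jump-down origin+f≡top ◅ ε
    where
    top : Fin n
    top = fromℕ< f<n
    u≤top : toℕ u ≤ toℕ top
    u≤top = subst (toℕ u ≤_) (sym (toℕ-fromℕ< f<n)) (<⇒≤ (≰⇒> f≰u))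
    origin+f≡top : toℕ origin + f ≡ toℕ top
    origin+f≡top = trans (cong (_+ f) toℕ-origin) (sym (toℕ-fromℕ< f<n))

  stronglyConnected : ∀ u v → Star Alternating u v
  stronglyConnected u v = descend u (<-wellFounded u)
                          ◅◅ ascend (subst (_≤ toℕ v) (sym toℕ-origin) z≤n)

corollary5 : (n : ℕ) .{{_ : NonZero n}} → 3 ≤ n → ¬ (2 ∣ n) →
    (S : ℕ → Set) → (∀ s → S s → 1 ≤ s × s < n) → S 1 →
    Σ ℕ (λ e → S e × 2 ∣ e) →
    PCNumberAtMost (Circulant n S) 2
corollary5 n _ n-odd S bounds S1 (e , Se , 2∣e) =
  tailColouring , stronglyConnected⇒properlyConnected stronglyConnected
  where
  0<e : 0 < e
  0<e = proj₁ (bounds e Se)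
  f+e≡n : n ∸ e + e ≡ n
  f+e≡n = m∸n+n≡m (<⇒≤ (proj₂ (bounds e Se)))
  f-odd : ¬ 2 ∣ n ∸ e
  f-odd 2∣f = n-odd (subst (2 ∣_) f+e≡n (∣m∣n⇒∣m+n 2∣f 2∣e))
  open OddJump {S = S} S1 {f = n ∸ e} f+e≡n (¬2∣⇒parity≡1ℙ (n ∸ e) f-odd) 0<e Se
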